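{- For all $\alpha,i\ge1$, \[ \nu(\tilde x_{\alpha,i})\ge\alpha+\left\lfloor\tfrac12(5i-5)\right\rfloor, \] where $\nu(n)$ denotes the exponent of the exact power of $5$ dividing $n$ (with $\nu(0)=\infty$).
   Context: The matrix $M=(m_{i,j})_{i,j\ge1}$ has first five rows $(5,0,0,0,0,0,\dots)$, $(2\cdot5,\,5^3,0,0,0,0,\dots)$, $(9,\,3\cdot5^3,\,5^5,0,0,0,\dots)$, $(4,\,22\cdot5^2,\,4\cdot5^5,\,5^7,0,0,\dots)$, $(1,\,4\cdot5^3,\,8\cdot5^5,\,5^8,\,5^9,0,\dots)$; for $i\ge6$, $m_{i,1}=0$ and for $j\ge2$, $m_{i,j}=25m_{i-1,j-1}+25m_{i-2,j-1}+15m_{i-3,j-1}+5m_{i-4,j-1}+m_{i-5,j-1}$. Define $\tilde a_{i,j}=m_{6i-4,\,i-1+j}$ and $\tilde b_{i,j}=m_{6i-5,\,i-1+j}$. Row vectors $\tilde{\mathbf x}_\alpha=(\tilde x_{\alpha,1},\tilde x_{\alpha,2},\dots)$ are defined by $\tilde{\mathbf x}_1=(5,0,0,\dots)$ and, for $\alpha\ge1$, $\tilde x_{\alpha+1,j}=\sum_{i\ge1}\tilde x_{\alpha,i}\tilde a_{i,j}$ if $\alpha$ is odd, $\tilde x_{\alpha+1,j}=\sum_{i\ge1}\tilde x_{\alpha,i}\tilde b_{i,j}$ if $\alpha$ is even. $\lfloor\cdot\rfloor$ is the floor function. -}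

module Defs where

open import Data.Nat using (ℕ; zero; suc; _+_; _*_; _∸_; _^_)
open import Data.Bool using (Bool; true; false; if_then_else_)

-- The matrix M = (m i j), indices 1-based (index 0 is junk, value 0).
m : ℕ → ℕ → ℕ
m zero _ = 0
m _ zero = 0
m 1 1 = 5
m 1 (suc (suc _)) = 0
m 2 1 = 2 * 5
m 2 2 = 5 ^ 3
m 2 (suc (suc (suc _))) = 0
m 3 1 = 9
m 3 2 = 3 * 5 ^ 3
m 3 3 = 5 ^ 5
m 3 (suc (suc (suc (suc _)))) = 0
m 4 1 = 4
m 4 2 = 22 * 5 ^ 2
m 4 3 = 4 * 5 ^ 5
m 4 4 = 5 ^ 7
m 4 (suc (suc (suc (suc (suc _))))) = 0
m 5 1 = 1
m 5 2 = 4 * 5 ^ 3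
m 5 3 = 8 * 5 ^ 5
m 5 4 = 5 ^ 8
m 5 5 = 5 ^ 9
m 5 (suc (suc (suc (suc (suc (suc _)))))) = 0
m (suc (suc (suc (suc (suc (suc k)))))) 1 = 0
m (suc (suc (suc (suc (suc (suc k)))))) (suc (suc j)) =
  25 * m (suc (suc (suc (suc (suc k))))) (suc j)
  + 25 * m (suc (suc (suc (suc k)))) (suc j)
  + 15 * m (suc (suc (suc k))) (suc j)
  + 5 * m (suc (suc k)) (suc j)
  + m (suc k) (suc j)

ã : ℕ → ℕ → ℕ
ã i j = m (6 * i ∸ 4) (i ∸ 1 + j)

b̃ : ℕ → ℕ → ℕ
b̃ i j = m (6 * i ∸ 5) (i ∸ 1 + j)

sum1 : ℕ → (ℕ → ℕ) → ℕ
sum1 zero f = 0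
sum1 (suc n) f = sum1 n f + f (suc n)

isOdd : ℕ → Bool
isOdd zero = false
isOdd (suc n) = if isOdd n then false else true

-- The row vector x̃_α is supported on indices
-- 1 .. 5^(α-1) (M is lower triangular, so ã i j = b̃ i j = 0 for j > 5i),
-- hence the (formally infinite) sum over i ≥ 1 equals the sum over
-- i = 1 .. 5^α.
x̃ : ℕ → ℕ → ℕ
x̃ zero _ = 0
x̃ 1 1 = 5
x̃ 1 _ = 0
x̃ (suc (suc α)) j =
  sum1 (5 ^ suc α)
    (λ i → x̃ (suc α) i * (if isOdd (suc α) then ã i j else b̃ i j))

{-# OPTIONS --safe #-}
module Submission where

-- Bounds on the 5-adic valuation ν are encoded as "5 ^ k ∣ x for every k with
-- 2k + a ≤ b", i.e. ν(x) ≥ (b − a)/2 without division.  Along the recurrence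
-- for M the row index drops by r ∈ {1, …, 5} and the column by 1, while the
-- coefficients 25, 25, 15, 5, 1 contribute 5 ^ e with 2e + r ≥ 5; so
-- 5 ^ k ∣ m i j whenever 2k + i < 5j, the first five rows being a direct check.
-- On the diagonal bands defining ã and b̃ this becomes 2k + i + 1 < 5j.  Then
-- 2ν(x̃ α j) ≥ 2α + 5j − 5 by induction on α: in the term x̃ α i · c i j of
-- x̃ (α + 1) j even the weak estimate ν(x̃ α i) ≥ α + i − 1 suffices, because
-- the coefficient bound loses only i/2.

open import Defs
open import Data.Nat using (ℕ; zero; suc; _+_; _*_; _∸_; _^_; _≤_; _<_; s≤s⁻¹)
open import Data.Nat.DivMod using (_/_; m/n*n≤m)
open import Data.Nat.Divisibility
  using (_∣_; divides; _∣0; ∣-refl; ∣-trans; ∣m∣n⇒∣m+n; ∣m⇒∣m*n; ∣n⇒∣m*n; *-pres-∣)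
open import Data.Nat.Properties
open import Data.Nat.Tactic.RingSolver using (solve)
open import Data.List using (_∷_; [])
open import Data.Product using (_,_)
open import Data.Sum using (inj₁; inj₂)
open import Data.Bool using (true; false; if_then_else_)
open import Relation.Binary.PropositionalEquality using (_≡_; refl; sym; cong; subst)

^-∣-^ : ∀ p {k n} → k ≤ n → p ^ k ∣ p ^ n
^-∣-^ p {k} k≤n with m≤n⇒∃[o]m+o≡n k≤n
... | o , refl = subst (p ^ k ∣_) (sym (^-distribˡ-+-* p k o)) (∣m⇒∣m*n (p ^ o) ∣-refl)

^-∣-* : ∀ p k {e c x} → p ^ e ∣ c → (∀ k′ → k ≡ e + k′ → p ^ k′ ∣ x) → p ^ k ∣ c * x
^-∣-* p k {e} pᵉ∣c rest with ≤-total k e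
... | inj₁ k≤e = ∣m⇒∣m*n _ (∣-trans (^-∣-^ p k≤e) pᵉ∣c)
... | inj₂ e≤k with m≤n⇒∃[o]m+o≡n e≤k
...   | k′ , refl =
  subst (_∣ _) (sym (^-distribˡ-+-* p e k′)) (*-pres-∣ pᵉ∣c (rest k′ refl))

∣-sum1 : ∀ {d} n {f} → (∀ i → d ∣ f (suc i)) → d ∣ sum1 n f
∣-sum1 zero    d∣f = _ ∣0
∣-sum1 (suc n) d∣f = ∣m∣n⇒∣m+n (∣-sum1 n d∣f) (d∣f n)

2k+a<2[1+e]+a⇒k≤e : ∀ k {a} e → 2 * k + a < 2 * suc e + a → k ≤ e
2k+a<2[1+e]+a⇒k≤e k {a} e lt =
  s≤s⁻¹ (*-cancelˡ-< 2 k (suc e) (+-cancelʳ-< a (2 * k) (2 * suc e) lt))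

∣-entry : ∀ k {a b} c e → 2 * k + a < b → b ≤ 2 * suc e + a → 5 ^ k ∣ c * 5 ^ e
∣-entry k c e lt b≤ = ∣n⇒∣m*n c (^-∣-^ 5 (2k+a<2[1+e]+a⇒k≤e k e (<-≤-trans lt b≤)))

shift-bound : ∀ {a b} k k′ e r → k ≡ e + k′ → 5 ≤ 2 * e + r →
              2 * k + (r + a) < 5 + b → 2 * k′ + a < b
shift-bound {a} {b} _ k′ e r refl 5≤ lt = +-cancelˡ-< 5 (2 * k′ + a) b (begin-strict
  5 + (2 * k′ + a)           ≤⟨ +-monoˡ-≤ (2 * k′ + a) 5≤ ⟩
  2 * e + r + (2 * k′ + a)   ≡⟨ solve (e ∷ r ∷ k′ ∷ a ∷ []) ⟩
  2 * (e + k′) + (r + a)     <⟨ lt ⟩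
  5 + b                      ∎)
  where open ≤-Reasoning

∣-scaled : ∀ k {a b c x} e r → 5 ^ e ∣ c → 5 ≤ 2 * e + r → 2 * k + (r + a) < 5 + b →
           (∀ k′ → 2 * k′ + a < b → 5 ^ k′ ∣ x) → 5 ^ k ∣ c * x
∣-scaled k e r 5ᵉ∣c 5≤ lt bound =
  ^-∣-* 5 k 5ᵉ∣c (λ k′ k≡ → bound k′ (shift-bound k k′ e r k≡ 5≤ lt))

m-bound : ∀ i j k → 2 * k + i < 5 * j → 5 ^ k ∣ m i j
m-bound zero _ _ _ = _ ∣0
m-bound (suc _) zero _ _ = _ ∣0
-- Rows 1–5: each entry is written as c * 5 ^ e, and the closed side condition
-- b ≤ 2 * suc e + a is decided by evaluating ≤ᵇ.
m-bound 1 1 k lt = ∣-entry k 1 1 lt (≤ᵇ⇒≤ _ _ _)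
m-bound 1 (suc (suc j)) _ _ = _ ∣0
m-bound 2 1 k lt = ∣-entry k 2 1 lt (≤ᵇ⇒≤ _ _ _)
m-bound 2 2 k lt = ∣-entry k 1 3 lt (≤ᵇ⇒≤ _ _ _)
m-bound 2 (suc (suc (suc j))) _ _ = _ ∣0
m-bound 3 1 k lt = ∣-entry k 9 0 lt (≤ᵇ⇒≤ _ _ _)
m-bound 3 2 k lt = ∣-entry k 3 3 lt (≤ᵇ⇒≤ _ _ _)
m-bound 3 3 k lt = ∣-entry k 1 5 lt (≤ᵇ⇒≤ _ _ _)
m-bound 3 (suc (suc (suc (suc j)))) _ _ = _ ∣0
m-bound 4 1 k lt = ∣-entry k 4 0 lt (≤ᵇ⇒≤ _ _ _)
m-bound 4 2 k lt = ∣-entry k 22 2 lt (≤ᵇ⇒≤ _ _ _)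
m-bound 4 3 k lt = ∣-entry k 4 5 lt (≤ᵇ⇒≤ _ _ _)
m-bound 4 4 k lt = ∣-entry k 1 7 lt (≤ᵇ⇒≤ _ _ _)
m-bound 4 (suc (suc (suc (suc (suc j))))) _ _ = _ ∣0
m-bound 5 1 k lt = ∣-entry k 1 0 lt (≤ᵇ⇒≤ _ _ _)
m-bound 5 2 k lt = ∣-entry k 4 3 lt (≤ᵇ⇒≤ _ _ _)
m-bound 5 3 k lt = ∣-entry k 8 5 lt (≤ᵇ⇒≤ _ _ _)
m-bound 5 4 k lt = ∣-entry k 1 8 lt (≤ᵇ⇒≤ _ _ _)
m-bound 5 5 k lt = ∣-entry k 1 9 lt (≤ᵇ⇒≤ _ _ _)
m-bound 5 (suc (suc (suc (suc (suc (suc j)))))) _ _ = _ ∣0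
m-bound (suc (suc (suc (suc (suc (suc i)))))) 1 _ _ = _ ∣0
m-bound (suc i₅@(suc i₄@(suc i₃@(suc i₂@(suc i₁@(suc i)))))) (suc (suc j)) k lt =
  ∣m∣n⇒∣m+n (∣m∣n⇒∣m+n (∣m∣n⇒∣m+n (∣m∣n⇒∣m+n
    (∣-scaled k 2 1 ∣-refl ≤-refl lt′ (m-bound i₅ (suc j)))
    (∣-scaled k 2 2 ∣-refl (≤ᵇ⇒≤ _ _ _) lt′ (m-bound i₄ (suc j))))
    (∣-scaled k 1 3 (divides 3 refl) ≤-refl lt′ (m-bound i₃ (suc j))))
    (∣-scaled k 1 4 ∣-refl (≤ᵇ⇒≤ _ _ _) lt′ (m-bound i₂ (suc j))))
    (m-bound i₁ (suc j) k (shift-bound k k 0 5 refl ≤-refl lt′))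
  where
  lt′ : 2 * k + suc i₅ < 5 + 5 * suc j
  lt′ = subst (2 * k + suc i₅ <_) (*-suc 5 (suc j)) lt

band-bound : ∀ k c i j → 2 * k + (c + i) < 5 * j → 2 * k + (c + 6 * i) < 5 * (i + j)
band-bound k c i j lt = begin-strict
  2 * k + (c + 6 * i)          ≡⟨ solve (k ∷ c ∷ i ∷ []) ⟩
  5 * i + (2 * k + (c + i))    <⟨ +-monoʳ-< (5 * i) lt ⟩
  5 * i + 5 * j                ≡⟨ sym (*-distribˡ-+ 5 i j) ⟩
  5 * (i + j)                  ∎
  where open ≤-Reasoning

ã-bound : ∀ i j k → 2 * k + suc i < 5 * j → 5 ^ k ∣ ã i j
ã-bound zero _ _ _ = _ ∣0
ã-bound (suc i) j k lt = subst (λ r → 5 ^ k ∣ m r (i + j)) (sym (cong (_∸ 4) (*-suc 6 i)))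
  (m-bound (2 + 6 * i) (i + j) k (band-bound k 2 i j lt))

b̃-bound : ∀ i j k → 2 * k + i < 5 * j → 5 ^ k ∣ b̃ i j
b̃-bound zero _ _ _ = _ ∣0
b̃-bound (suc i) j k lt = subst (λ r → 5 ^ k ∣ m r (i + j)) (sym (cong (_∸ 5) (*-suc 6 i)))
  (m-bound (1 + 6 * i) (i + j) k (band-bound k 1 i j lt))

coefficient-bound : ∀ b i j k → 2 * k + suc i < 5 * j →
                    5 ^ k ∣ (if b then ã i j else b̃ i j)
coefficient-bound true  i j k lt = ã-bound i j k lt
coefficient-bound false i j k lt =
  b̃-bound i j k (<-trans (+-monoʳ-< (2 * k) (n<1+n i)) lt)

factor-bound : ∀ a i → 2 * (a + i) + 5 ≤ 2 * a + 5 * suc i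
factor-bound a i = begin
  2 * (a + i) + 5      ≡⟨ solve (a ∷ i ∷ []) ⟩
  2 * a + 5 + 2 * i    ≤⟨ +-monoʳ-≤ (2 * a + 5) (*-monoˡ-≤ i (≤ᵇ⇒≤ 2 5 _)) ⟩
  2 * a + 5 + 5 * i    ≡⟨ solve (a ∷ i ∷ []) ⟩
  2 * a + 5 * suc i    ∎
  where open ≤-Reasoning

cofactor-bound : ∀ a i j k → 2 * (a + i + k) + 5 ≤ 2 * suc a + 5 * j →
                 2 * k + suc (suc i) < 5 * j
cofactor-bound a i j k le = +-cancelˡ-≤ (2 * suc a) _ _ (begin
  2 * suc a + suc (2 * k + suc (suc i))        ≤⟨ m≤m+n _ i ⟩
  2 * suc a + suc (2 * k + suc (suc i)) + i    ≡⟨ solve (a ∷ i ∷ k ∷ []) ⟩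
  2 * (a + i + k) + 5                          ≤⟨ le ⟩
  2 * suc a + 5 * j                            ∎)
  where open ≤-Reasoning

x̃-bound : ∀ α j k → 2 * k + 5 ≤ 2 * α + 5 * j → 5 ^ k ∣ x̃ α j
x̃-bound zero _ _ _ = _ ∣0
x̃-bound 1 zero _ _ = _ ∣0
x̃-bound 1 1 k le = ∣-entry k 1 1 (subst (_≤ 7) (+-suc (2 * k) 4) le) (≤ᵇ⇒≤ _ _ _)
x̃-bound 1 (suc (suc j)) _ _ = _ ∣0
x̃-bound (suc (suc α)) j k le = ∣-sum1 (5 ^ suc α) λ i →
  ^-∣-* 5 k (x̃-bound (suc α) (suc i) (suc α + i) (factor-bound (suc α) i))
    (λ k′ k≡ → coefficient-bound (isOdd (suc α)) (suc i) j k′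
      (cofactor-bound (suc α) i j k′ (subst (λ n → 2 * n + 5 ≤ 2 * suc (suc α) + 5 * j) k≡ le)))

lemma3p2 : (α i : ℕ) → 1 ≤ α → 1 ≤ i →
    5 ^ (α + (5 * i ∸ 5) / 2) ∣ x̃ α i
lemma3p2 α i _ 1≤i =
  x̃-bound α i (α + (5 * i ∸ 5) / 2) (exponent-bound _ (m/n*n≤m (5 * i ∸ 5) 2))
  where
  open ≤-Reasoning
  exponent-bound : ∀ q → q * 2 ≤ 5 * i ∸ 5 → 2 * (α + q) + 5 ≤ 2 * α + 5 * i
  exponent-bound q 2q≤ = begin
    2 * (α + q) + 5            ≡⟨ solve (α ∷ q ∷ []) ⟩
    2 * α + (q * 2 + 5)        ≤⟨ +-monoʳ-≤ (2 * α) (+-monoˡ-≤ 5 2q≤) ⟩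
    2 * α + (5 * i ∸ 5 + 5)    ≡⟨ cong (2 * α +_) (m∸n+n≡m (*-monoʳ-≤ 5 1≤i)) ⟩
    2 * α + 5 * i              ∎
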